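{- Let $R$, $\mathcal T$, $\ell$, $a$ and $d$ be as in the context. Let $n\ge 1$ and let $v$ be a node of $\mathcal T$ with $\ell(v)=n$ which is labelled $[k]$ for some integer $k\ge 1$ (equivalently, $a(n)-a(n-1)=1$). Then the parent of $v$ has exactly $r_{d(n)}+1$ children.
   Context: Let $R=\langle s,r_1,r_2,\ldots\rangle$ be a sequence of nonnegative integers with $s\ge 1$. Let $\Sigma=\{\mathtt r,\mathtt 0,\mathtt 1,\mathtt 2,\ldots\}$ be the infinite alphabet consisting of a letter $\mathtt r$ together with a letter $[j]$ for each integer $j\ge 0$ (so $[0]=\mathtt 0$). For a letter $\mathtt x$ and $m\ge0$, $\mathtt x^m$ is the word of $m$ copies of $\mathtt x$. Let $\sigma$ be the morphism of words over $\Sigma$ defined by $\sigma(\mathtt r)=\mathtt r\,\mathtt 0^{s}$ and $\sigma([j])=[j+1]\,\mathtt 0^{r_{j+1}}$ for $j\ge 0$. Let $\mathcal T$ be the infinite rooted ordered tree whose root is labelled $\mathtt r$ and in which the labels of the children of any node labelled $\mathtt x$, read left to right, spell $\sigma(\mathtt x)$. For a node $v$, $\ell(v)$ is the number of nodes in the same row (depth) as $v$ lying strictly to its left. Define $a:\mathbb Z\to\mathbb Z_{\ge0}$ by $a(n)=0$ for $n<0$ and $a(\ell(v))=\ell(\mathrm{parent}(v))$ for every non-root node $v$ of $\mathcal T$ (this is well defined). Let $a^0$ be the identity and $a^k$ the $k$-fold composition of $a$. For $n\ge 1$ define $d(n)=\max\{k\ge 0: a^k(n)-a^k(n-1)=1\}$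 (this maximum exists). -}

module Defs where

open import Data.Nat using (ℕ; zero; suc; _∸_; _≟_)
open import Data.List using (List; []; _∷_; _++_; map; replicate; filter; length)
open import Data.Product using (_×_; _,_; proj₁; proj₂)
open import Data.Fin using (Fin; toℕ)
open import Relation.Binary.PropositionalEquality using (_≡_)

-- The alphabet Σ = {r, 0, 1, 2, ...}:  rt is the letter r, num j is [j].
data Letter : Set where
  rt  : Letter
  num : ℕ → Letter

-- The morphism σ for R = ⟨s, r₁, r₂, ...⟩; the sequence r is given as a
-- function ℕ → ℕ with r j = r_j for j ≥ 1 (the value r 0 is never used).
σ : ℕ → (ℕ → ℕ) → Letter → List Letter
σ s r rt      = rt ∷ replicate s (num 0)
σ s r (num j) = num (suc j) ∷ replicate (r (suc j)) (num 0)

-- Given a row of the tree (labels, left to right) whose first node has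
-- position i, list the children row: each child is recorded as
-- (position of its parent in the previous row , its label).
childrenFrom : ℕ → (ℕ → ℕ) → ℕ → List Letter → List (ℕ × Letter)
childrenFrom s r i []       = []
childrenFrom s r i (x ∷ xs) = map (λ y → (i , y)) (σ s r x) ++ childrenFrom s r (suc i) xs

-- Row m lists the nodes of depth m from left to
-- right; the node at list index p has ℓ = p.  Each entry is
-- (ℓ(parent) , label); for the root the parent component is a dummy 0.
rowP : ℕ → (ℕ → ℕ) → ℕ → List (ℕ × Letter)
rowP s r zero    = (0 , rt) ∷ []
rowP s r (suc m) = childrenFrom s r 0 (map proj₂ (rowP s r m))

numChildren : ℕ → (ℕ → ℕ) → ℕ → ℕ → ℕ
numChildren s r m q = length (filter (λ e → proj₁ e ≟ q) (rowP s r (suc m)))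

-- The defining property of a (restricted to ℕ):
-- a(ℓ(v)) = ℓ(parent v) for every non-root node v.
IsA : ℕ → (ℕ → ℕ) → (ℕ → ℕ) → Set
IsA s r a = ∀ m (p : Fin (length (rowP s r (suc m)))) →
  a (toℕ p) ≡ proj₁ (Data.List.lookup (rowP s r (suc m)) p)

iter : (ℕ → ℕ) → ℕ → ℕ → ℕ
iter f zero    x = x
iter f (suc k) x = f (iter f k x)

StepAt : (ℕ → ℕ) → ℕ → ℕ → Set
StepAt a n k = iter a k n ≡ suc (iter a k (n ∸ 1))

IsD : (ℕ → ℕ) → ℕ → ℕ → Set
IsD a n k = StepAt a n k × (∀ j → StepAt a n j → Data.Nat._≤_ j k)

-- Consecutive nodes of a row either share a parent (and then the second one
-- is labelled 0) or have consecutive parents (and then the second one is a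
-- first child, with a nonzero label).  Hence a node at position n ≥ 1
-- labelled [i] satisfies a(n) − a(n−1) = 1 exactly when i ≥ 1, and then its
-- parent, at position a(n), is labelled [i−1].  Since every row is a prefix of
-- the next, induction on i gives d(n) = i; and a node labelled [i−1] has
-- |σ([i−1])| = r_i + 1 children.
module Submission where

open import Defs
open import Data.Empty using (⊥-elim)
open import Data.Fin using (Fin; toℕ; zero; suc)
open import Data.List using (List; []; _∷_; _++_; map; replicate; filter; length; lookup; head; concatMap)
open import Data.List.Membership.Propositional using (_∈_)
open import Data.List.Properties using (map-++; map-∘; length-replicate; map-id; concatMap-++; filter-++; length-++; filter-accept; filter-reject)
open import Data.List.Relation.Unary.Any using (here; there)
open import Data.List.Relation.Unary.Linked using (Linked; []; _∷_; _∷′_)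
open import Data.Maybe using (Maybe; just; nothing)
open import Data.Maybe.Relation.Binary.Connected using (Connected; just; just-nothing)
open import Data.Nat using (ℕ; zero; suc; _+_; _≤_; _<_; _≟_; z≤n; s≤s)
open import Data.Nat.Properties using (+-suc; +-identityʳ; ≤-antisym; 1+n≢n; >⇒≢; m<n⇒m<1+n; n<1+n; m≢1+m+n)
open import Data.Product using (_×_; _,_; proj₁; proj₂; ∃-syntax)
open import Function using (id; _∘_)
open import Relation.Nullary using (Dec)
open import Relation.Binary.PropositionalEquality using (_≡_; _≢_; refl; sym; trans; cong; cong₂; subst; module ≡-Reasoning)

open ≡-Reasoning

private
  variable
    A B : Set
    x y : A
    xs : List A
    n : ℕ

_⁉_ : List A → ℕ → Maybe A
[]       ⁉ _     = nothing
(x ∷ xs) ⁉ zero  = just x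
(x ∷ xs) ⁉ suc n = xs ⁉ n

⁉-lookup : (xs : List A) (p : Fin (length xs)) → xs ⁉ toℕ p ≡ just (lookup xs p)
⁉-lookup (x ∷ xs) zero    = refl
⁉-lookup (x ∷ xs) (suc p) = ⁉-lookup xs p

⁉⇒lookup : ∀ xs {n} → xs ⁉ n ≡ just x → ∃[ p ] toℕ p ≡ n × lookup xs p ≡ x
⁉⇒lookup (_ ∷ _)  {zero}  refl = zero , refl , refl
⁉⇒lookup (_ ∷ xs) {suc n} eq with p , refl , eq′ ← ⁉⇒lookup xs eq = suc p , refl , eq′

⁉⇒∈ : ∀ xs {n} → xs ⁉ n ≡ just x → x ∈ xs
⁉⇒∈ (_ ∷ _)  {zero}  refl = here refl
⁉⇒∈ (_ ∷ xs) {suc n} eq   = there (⁉⇒∈ xs eq)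

⁉-pred : ∀ xs {n} → xs ⁉ suc n ≡ just x → ∃[ y ] xs ⁉ n ≡ just y
⁉-pred (y ∷ _)  {zero}  _  = y , refl
⁉-pred (_ ∷ xs) {suc n} eq = ⁉-pred xs eq

⁉-++ˡ : ∀ xs {n} ys → xs ⁉ n ≡ just x → (xs ++ ys) ⁉ n ≡ just x
⁉-++ˡ (_ ∷ _)  {zero}  _ eq = eq
⁉-++ˡ (_ ∷ xs) {suc n} ys eq = ⁉-++ˡ xs ys eq

⁉-map⁻ : ∀ (f : A → B) xs → map f xs ⁉ n ≡ just y → ∃[ x ] xs ⁉ n ≡ just x × f x ≡ y
⁉-map⁻ {n = zero}  f (x ∷ xs) refl = x , refl , refl
⁉-map⁻ {n = suc n} f (x ∷ xs) eq   = ⁉-map⁻ f xs eq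

Linked-⁉ : {R : A → A → Set} → Linked R xs → xs ⁉ n ≡ just x → xs ⁉ suc n ≡ just y → R x y
Linked-⁉ {n = zero}  (Rxy ∷ _) refl refl = Rxy
Linked-⁉ {n = suc n} (_ ∷ R[xs]) eq eq′ = Linked-⁉ R[xs] eq eq′

offset-∷ : ∀ i {q} → (∃[ t ] q ≡ suc i + t × xs ⁉ t ≡ just y) → ∃[ t ] q ≡ i + t × (x ∷ xs) ⁉ t ≡ just y
offset-∷ i (t , eq , at) = suc t , trans eq (sym (+-suc i t)) , at

iter-suc : ∀ (f : ℕ → ℕ) k x → iter f (suc k) x ≡ iter f k (f x)
iter-suc f zero    x = refl
iter-suc f (suc k) x = cong f (iter-suc f k x)

module _ {a : ℕ → ℕ} where

  StepAt-suc : ∀ {n q k} → a (suc n) ≡ suc q → a n ≡ q → StepAt a (suc n) (suc k) ≡ StepAt a (suc q) k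
  StepAt-suc {n} {q} {k} eq₁ eq₂ = begin
    StepAt a (suc n) (suc k)                      ≡⟨ cong₂ (λ u v → u ≡ suc v) (iter-suc a k (suc n)) (iter-suc a k n) ⟩
    (iter a k (a (suc n)) ≡ suc (iter a k (a n))) ≡⟨ cong₂ (λ u v → iter a k u ≡ suc (iter a k v)) eq₁ eq₂ ⟩
    StepAt a (suc q) k                            ∎

  IsD-suc : ∀ {n q k} → a (suc n) ≡ suc q → a n ≡ q → IsD a (suc q) k → IsD a (suc n) (suc k)
  IsD-suc {n} {q} {k} eq₁ eq₂ (step , maximal) = subst id (sym (StepAt-suc {k = k} eq₁ eq₂)) step , bound
    where
    bound : ∀ j → StepAt a (suc n) j → j ≤ suc k
    bound zero    _    = z≤n
    bound (suc j) step′ = s≤s (maximal j (subst id (StepAt-suc {k = j} eq₁ eq₂) step′))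

  IsD-zero : ∀ {q} → a (suc q) ≡ a q → IsD a (suc q) 0
  IsD-zero {q} eq = refl , bound
    where
    bound : ∀ j → StepAt a (suc q) j → j ≤ 0
    bound zero    _    = z≤n
    bound (suc j) step = ⊥-elim (1+n≢n (sym (trans (sym same) step)))
      where
      same : iter a (suc j) (suc q) ≡ iter a (suc j) q
      same = trans (iter-suc a j (suc q)) (trans (cong (iter a j) eq) (sym (iter-suc a j q)))

  IsD-unique : ∀ {n k k′} → IsD a n k → IsD a n k′ → k ≡ k′
  IsD-unique (step , maximal) (step′ , maximal′) = ≤-antisym (maximal′ _ step) (maximal _ step′)

Entry : Set
Entry = ℕ × Letter

-- The label of a first child is r or [j+1], never 0.
data Adjacent : Entry → Entry → Set where
  sibling    : ∀ {q x}   → Adjacent (q , x) (q , num 0)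
  firstChild : ∀ {q x y} → y ≢ num 0 → Adjacent (q , x) (suc q , y)

childOf? : ∀ q (e : Entry) → Dec (proj₁ e ≡ q)
childOf? q e = proj₁ e ≟ q

childCount : ℕ → List Entry → ℕ
childCount q = length ∘ filter (childOf? q)

childCount-++ : ∀ q xs ys → childCount q (xs ++ ys) ≡ childCount q xs + childCount q ys
childCount-++ q xs ys = trans (cong length (filter-++ (childOf? q) xs ys)) (length-++ (filter (childOf? q) xs))

childCount-own : ∀ q (l : List Letter) → childCount q (map (q ,_) l) ≡ length l
childCount-own q []      = refl
childCount-own q (_ ∷ l) = trans (cong length (filter-accept (childOf? q) refl)) (cong suc (childCount-own q l))

childCount-other : ∀ {i q} → i ≢ q → (l : List Letter) → childCount q (map (i ,_) l) ≡ 0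
childCount-other i≢q []      = refl
childCount-other i≢q (_ ∷ l) = trans (cong length (filter-reject (childOf? _) i≢q)) (childCount-other i≢q l)

module _ (s : ℕ) (r : ℕ → ℕ) where

  family-linked : ∀ i y k {rest} → (∀ {x} → Connected Adjacent (just (i , x)) (head rest)) → Linked Adjacent rest →
                  Linked Adjacent ((i , y) ∷ map (i ,_) (replicate k (num 0)) ++ rest)
  family-linked i y zero    next linked = next ∷′ linked
  family-linked i y (suc k) next linked = sibling ∷ family-linked i (num 0) k next linked

  childrenFrom-head : ∀ i xs {x} → Connected Adjacent (just (i , x)) (head (childrenFrom s r (suc i) xs))
  childrenFrom-head i []          = just-nothing
  childrenFrom-head i (rt ∷ _)    = just (firstChild λ ())
  childrenFrom-head i (num _ ∷ _) = just (firstChild λ ())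

  childrenFrom-linked : ∀ i xs → Linked Adjacent (childrenFrom s r i xs)
  childrenFrom-linked i []           = []
  childrenFrom-linked i (rt ∷ xs)    =
    family-linked i rt s (childrenFrom-head i xs) (childrenFrom-linked (suc i) xs)
  childrenFrom-linked i (num j ∷ xs) =
    family-linked i (num (suc j)) (r (suc j)) (childrenFrom-head i xs) (childrenFrom-linked (suc i) xs)

  skip-zeros : ∀ {i k q j : ℕ} {rest : List Entry} → (q , num (suc j)) ∈ map (i ,_) (replicate k (num 0)) ++ rest →
               (q , num (suc j)) ∈ rest
  skip-zeros {k = zero}  e∈ = e∈
  skip-zeros {k = suc k} (there e∈) = skip-zeros {k = k} e∈

  childrenFrom-parent : ∀ i xs {q j} → (q , num (suc j)) ∈ childrenFrom s r i xs →
                        ∃[ t ] q ≡ i + t × xs ⁉ t ≡ just (num j)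
  childrenFrom-parent i (rt ∷ xs)    (there e∈) = offset-∷ i (childrenFrom-parent (suc i) xs (skip-zeros e∈))
  childrenFrom-parent i (num _ ∷ xs) (here refl) = 0 , sym (+-identityʳ i) , refl
  childrenFrom-parent i (num _ ∷ xs) (there e∈) = offset-∷ i (childrenFrom-parent (suc i) xs (skip-zeros e∈))

  childrenFrom-childCount-< : ∀ {q i} → q < i → ∀ xs → childCount q (childrenFrom s r i xs) ≡ 0
  childrenFrom-childCount-< q<i []       = refl
  childrenFrom-childCount-< {q} {i} q<i (x ∷ xs) = begin
    childCount q (map (i ,_) (σ s r x) ++ childrenFrom s r (suc i) xs)
      ≡⟨ childCount-++ q (map (i ,_) (σ s r x)) _ ⟩
    childCount q (map (i ,_) (σ s r x)) + childCount q (childrenFrom s r (suc i) xs)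
      ≡⟨ cong₂ _+_ (childCount-other (>⇒≢ q<i) (σ s r x)) (childrenFrom-childCount-< (m<n⇒m<1+n q<i) xs) ⟩
    0 ∎

  childrenFrom-childCount : ∀ i xs {t x} → xs ⁉ t ≡ just x → childCount (i + t) (childrenFrom s r i xs) ≡ length (σ s r x)
  childrenFrom-childCount i (x ∷ xs) {zero} refl rewrite +-identityʳ i = begin
    childCount i (map (i ,_) (σ s r x) ++ childrenFrom s r (suc i) xs)
      ≡⟨ childCount-++ i (map (i ,_) (σ s r x)) _ ⟩
    childCount i (map (i ,_) (σ s r x)) + childCount i (childrenFrom s r (suc i) xs)
      ≡⟨ cong₂ _+_ (childCount-own i (σ s r x)) (childrenFrom-childCount-< (n<1+n i) xs) ⟩
    length (σ s r x) + 0
      ≡⟨ +-identityʳ _ ⟩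
    length (σ s r x) ∎
  childrenFrom-childCount i (y ∷ xs) {suc t} {x} eq rewrite +-suc i t = begin
    childCount (suc (i + t)) (map (i ,_) (σ s r y) ++ childrenFrom s r (suc i) xs)
      ≡⟨ childCount-++ _ (map (i ,_) (σ s r y)) _ ⟩
    childCount (suc (i + t)) (map (i ,_) (σ s r y)) + childCount (suc (i + t)) (childrenFrom s r (suc i) xs)
      ≡⟨ cong₂ _+_ (childCount-other (m≢1+m+n i) (σ s r y)) (childrenFrom-childCount (suc i) xs eq) ⟩
    length (σ s r x) ∎

  labels-childrenFrom : ∀ i xs → map proj₂ (childrenFrom s r i xs) ≡ concatMap (σ s r) xs
  labels-childrenFrom i []       = refl
  labels-childrenFrom i (x ∷ xs) = begin
    map proj₂ (map (i ,_) (σ s r x) ++ childrenFrom s r (suc i) xs)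
      ≡⟨ map-++ proj₂ (map (i ,_) (σ s r x)) _ ⟩
    map proj₂ (map (i ,_) (σ s r x)) ++ map proj₂ (childrenFrom s r (suc i) xs)
      ≡⟨ cong₂ _++_ (trans (sym (map-∘ (σ s r x))) (map-id (σ s r x))) (labels-childrenFrom (suc i) xs) ⟩
    σ s r x ++ concatMap (σ s r) xs ∎

  rowLabels : ℕ → List Letter
  rowLabels m = map proj₂ (rowP s r m)

  -- The root label r begins σ(r), so each row begins with the previous one.
  rowLabels-prefix : ∀ m → ∃[ rest ] rowLabels (suc m) ≡ rowLabels m ++ rest
  rowLabels-prefix zero = replicate s (num 0) ++ [] , labels-childrenFrom 0 (rt ∷ [])
  rowLabels-prefix (suc m) with rest , eq ← rowLabels-prefix m = concatMap (σ s r) rest , (begin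
    rowLabels (suc (suc m))
      ≡⟨ labels-childrenFrom 0 (rowLabels (suc m)) ⟩
    concatMap (σ s r) (rowLabels (suc m))
      ≡⟨ cong (concatMap (σ s r)) eq ⟩
    concatMap (σ s r) (rowLabels m ++ rest)
      ≡⟨ concatMap-++ (σ s r) (rowLabels m) rest ⟩
    concatMap (σ s r) (rowLabels m) ++ concatMap (σ s r) rest
      ≡⟨ cong (_++ _) (labels-childrenFrom 0 (rowLabels m)) ⟨
    rowLabels (suc m) ++ concatMap (σ s r) rest ∎)

  rowLabels-next : ∀ m {q x} → rowLabels m ⁉ q ≡ just x → ∃[ q₂ ] rowP s r (suc m) ⁉ q ≡ just (q₂ , x)
  rowLabels-next m {q} {x} lbl with rest , eq ← rowLabels-prefix m
    with (q₂ , _) , entry , refl ← ⁉-map⁻ proj₂ (rowP s r (suc m))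
                                     (subst (λ L → L ⁉ q ≡ just x) (sym eq) (⁉-++ˡ (rowLabels m) rest lbl))
    = q₂ , entry

  numChildren-parent : ∀ m {q i} → (q , num (suc i)) ∈ rowP s r (suc m) → numChildren s r m q ≡ suc (r (suc i))
  numChildren-parent m e∈ with t , refl , lbl ← childrenFrom-parent 0 (rowLabels m) e∈ =
    trans (childrenFrom-childCount 0 (rowLabels m) lbl) (cong suc (length-replicate (r (suc _))))

  module _ (a : ℕ → ℕ) (isA : IsA s r a) (m : ℕ) where

    a-parent : ∀ {n q y} → rowP s r (suc m) ⁉ n ≡ just (q , y) → a n ≡ q
    a-parent entry with p , refl , refl ← ⁉⇒lookup (rowP s r (suc m)) entry = isA m p

    adjacent : ∀ {n e e′} → rowP s r (suc m) ⁉ n ≡ just e → rowP s r (suc m) ⁉ suc n ≡ just e′ → Adjacent e e′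
    adjacent = Linked-⁉ (childrenFrom-linked 0 (rowLabels m))

    IsD-num : ∀ i {n q} → 1 ≤ n → rowP s r (suc m) ⁉ n ≡ just (q , num i) → IsD a n i
    IsD-num zero {suc n} _ entry with _ , entry′ ← ⁉-pred (rowP s r (suc m)) entry with adjacent entry′ entry
    ... | sibling        = IsD-zero (trans (a-parent entry) (sym (a-parent entry′)))
    ... | firstChild 0≢0 = ⊥-elim (0≢0 refl)
    IsD-num (suc i) {suc n} _ entry with _ , entry′ ← ⁉-pred (rowP s r (suc m)) entry with adjacent entry′ entry
    ... | firstChild _
      with _ , refl , lbl ← childrenFrom-parent 0 (rowLabels m) (⁉⇒∈ (rowP s r (suc m)) entry)
      = IsD-suc (a-parent entry) (a-parent entry′) (IsD-num i (s≤s z≤n) (proj₂ (rowLabels-next m lbl)))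

lemma8 : (s : ℕ) (r : ℕ → ℕ) → 1 ≤ s →
         (a : ℕ → ℕ) → IsA s r a →
         (m : ℕ) (p : Fin (length (rowP s r (suc m)))) →
         1 ≤ toℕ p →
         (k : ℕ) → 1 ≤ k → proj₂ (lookup (rowP s r (suc m)) p) ≡ num k →
         (dn : ℕ) → IsD a (toℕ p) dn →
         numChildren s r m (proj₁ (lookup (rowP s r (suc m)) p)) ≡ suc (r dn)
lemma8 s r _ a isA m p 1≤p (suc i) _ label dn isD = begin
  numChildren s r m q ≡⟨ numChildren-parent s r m (⁉⇒∈ (rowP s r (suc m)) entry) ⟩
  suc (r (suc i))     ≡⟨ cong (suc ∘ r) (IsD-unique (IsD-num s r a isA m (suc i) 1≤p entry) isD) ⟩
  suc (r dn)          ∎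
  where
  q : ℕ
  q = proj₁ (lookup (rowP s r (suc m)) p)
  entry : rowP s r (suc m) ⁉ toℕ p ≡ just (q , num (suc i))
  entry = trans (⁉-lookup (rowP s r (suc m)) p) (cong (λ y → just (q , y)) label)
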